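{- For any building set $\mathcal{B}$, the nested complex $\mathcal{N}(\mathcal{B})$ is flag if and only if the extended nested complex $\mathcal{N}^{\square}(\mathcal{B})$ is flag.
   Context: A building set on a finite set $X$ is a collection $\mathcal{B}$ of nonempty subsets of $X$ containing all singletons and such that $I\cup J\in\mathcal{B}$ whenever $I,J\in\mathcal{B}$, $I\cap J\neq\varnothing$; $\mathcal{B}_{\max}$ is its set of inclusion-maximal elements. A nested collection is a subset $N\subseteq\mathcal{B}\setminus\mathcal{B}_{\max}$ whose members are pairwise nested or disjoint and such that no union of $k\ge2$ pairwise disjoint members lies in $\mathcal{B}$; $\mathcal{N}(\mathcal{B})$ is the simplicial complex on vertex set $\mathcal{B}\setminus\mathcal{B}_{\max}$ whose faces are the nested collections. An extended nested collection is a set $\{I_1,\dots,I_m,x_{i_1},\dots,x_{i_r}\}$ with $I_j\in\mathcal{B}$ (maximal elements allowed) and formal symbols $x_i$ ($i\in X$) such that the $I_j$ are pairwise nested or disjoint, no union of $k\ge2$ pairwise disjoint $I_j$'s lies in $\mathcal{B}$, and no $i_\ell$ lies in any $I_j$; $\mathcal{N}^{\square}(\mathcal{B})$ is the simplicial complex on vertex set $\mathcal{B}\cup\{x_i:i\in X\}$ whose faces are the extended nested collections. A simplicial complex is flag if a set of vertices is a face whenever every two of its vertices form an edge. -}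

module Defs where

open import Data.Nat using (ℕ; _≥_)
open import Data.Fin using (Fin)
open import Data.Fin.Subset using (Subset; _⊆_; _∩_; ⋃; Nonempty; Empty; _∈_; _∉_)
open import Data.List using (List; []; _∷_; length)
open import Data.List.Relation.Unary.All using (All)
open import Data.List.Relation.Unary.AllPairs using (AllPairs)
import Data.List.Membership.Propositional as LM
open import Data.Product using (_×_; Σ)
open import Data.Sum using (_⊎_; inj₁; inj₂)
open import Relation.Nullary using (¬_)
open import Relation.Unary using (Pred; Decidable)
open import Relation.Binary.PropositionalEquality using (_≡_)
open import Level using (0ℓ)

record BuildingSet (n : ℕ) : Set₁ where
  field
    B          : Pred (Subset n) 0ℓ
    B?         : Decidable B
    nonempty   : ∀ I → B I → Nonempty I
    singletons : ∀ (i : Fin n) → Σ (Subset n) (λ I → B I × (i ∈ I) × (∀ j → j ∈ I → j ≡ i))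
    union      : ∀ I J → B I → B J → Nonempty (I ∩ J) → B (I Data.Fin.Subset.∪ J)

Disjoint : ∀ {n} → Subset n → Subset n → Set
Disjoint I J = Empty (I ∩ J)

Maximal : ∀ {n} → BuildingSet n → Subset n → Set
Maximal 𝓑 I = B I × (∀ J → B J → I ⊆ J → J ≡ I)
  where open BuildingSet 𝓑

-- A finite set of vertices of a simplicial complex is represented by a list
-- (the underlying set of its entries).  A simplicial complex is given by its
-- face predicate on such lists.
-- Flag: a set of vertices is a face whenever every two of its vertices form
-- a face (an edge, or a vertex when the two coincide).
IsFlag : {V : Set} → (List V → Set) → Set
IsFlag {V} Face = ∀ (L : List V) →
  (∀ u v → u LM.∈ L → v LM.∈ L → Face (u ∷ v ∷ [])) → Face L

NestedOrDisjoint : ∀ {n} → Subset n → Subset n → Set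
NestedOrDisjoint I J = I ⊆ J ⊎ J ⊆ I ⊎ Disjoint I J

NoDisjointUnionIn : ∀ {n} → BuildingSet n → List (Subset n) → Set
NoDisjointUnionIn {n} 𝓑 L = ∀ (F : List (Subset n)) → length F ≥ 2 →
  All (LM._∈ L) F → AllPairs Disjoint F → ¬ BuildingSet.B 𝓑 (⋃ F)

IsNested : ∀ {n} → BuildingSet n → List (Subset n) → Set
IsNested 𝓑 L =
  All (λ I → BuildingSet.B 𝓑 I × ¬ Maximal 𝓑 I) L ×
  (∀ I J → I LM.∈ L → J LM.∈ L → NestedOrDisjoint I J) ×
  NoDisjointUnionIn 𝓑 L

-- Extended nested complex N^□(B): vertex set B ⊔ {x_i : i ∈ X};
-- inj₁ I is the vertex I ∈ B, inj₂ i is the formal symbol x_i.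
ExtVertex : ℕ → Set
ExtVertex n = Subset n ⊎ Fin n

sets : ∀ {n} → List (ExtVertex n) → List (Subset n)
sets [] = []
sets (inj₁ I ∷ L) = I ∷ sets L
sets (inj₂ _ ∷ L) = sets L

IsExtNested : ∀ {n} → BuildingSet n → List (ExtVertex n) → Set
IsExtNested 𝓑 L =
  All (λ I → BuildingSet.B 𝓑 I) (sets L) ×
  (∀ I J → I LM.∈ sets L → J LM.∈ sets L → NestedOrDisjoint I J) ×
  NoDisjointUnionIn 𝓑 (sets L) ×
  (∀ i I → inj₂ i LM.∈ L → inj₁ I LM.∈ L → i ∉ I)

module Submission where

open import Defs
open import Data.Nat using (ℕ; _≥_; s≤s; z≤n)
open import Data.Fin using (Fin)
open import Data.Fin.Subset using (Subset; _⊆_; ⋃; _∉_)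
  renaming (_∈_ to _∈ₛ_)
open import Data.Fin.Subset.Properties using (x∈p∩q⁺; p⊆p∪q; q⊆p∪q)
open import Data.List using (List; []; _∷_; length; map)
open import Data.List.Relation.Unary.All as All using (All; []; _∷_)
open import Data.List.Relation.Unary.All.Properties using (¬Any⇒All¬)
open import Data.List.Relation.Unary.Any using (Any; here; there)
open import Data.List.Relation.Unary.AllPairs using (AllPairs; _∷_)
open import Data.List.Membership.Propositional using (_∈_; find)
open import Data.List.Membership.Propositional.Properties using (∈-map⁻)
open import Data.Product using (_×_; _,_; ∃; proj₁; proj₂)
open import Data.Sum using (inj₁; inj₂)
open import Data.Empty using (⊥; ⊥-elim)
open import Function using (_∘_; id)
open import Function.Bundles using (_⇔_; mk⇔)
open import Relation.Nullary using (¬_; yes; no)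
open import Relation.Nullary.Decidable using (¬¬-excluded-middle)
open import Relation.Binary.PropositionalEquality using (_≡_; refl; cong; subst)

-- The two complexes agree on collections of non-maximal members of B, which
-- gives the backward direction.  Forward, the only non-local condition on an
-- extended collection is that no pairwise disjoint subfamily F with |F| ≥ 2
-- has ⋃ F ∈ B.  If F contains a maximal I, then ⋃ F ∈ B would force ⋃ F = I,
-- impossible since another member of F is nonempty and disjoint from I;
-- otherwise F is a clique of N(B), hence a face, which excludes ⋃ F ∈ B.
-- As the goal is ⊥, this case split costs only ¬¬-excluded-middle.

∈-sets⇒inj₁∈ : ∀ {n} {I : Subset n} (L : List (ExtVertex n)) → I ∈ sets L → inj₁ I ∈ L
∈-sets⇒inj₁∈ (inj₁ _ ∷ L) (here refl) = here refl
∈-sets⇒inj₁∈ (inj₁ _ ∷ L) (there I∈) = there (∈-sets⇒inj₁∈ L I∈)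
∈-sets⇒inj₁∈ (inj₂ _ ∷ L) I∈         = there (∈-sets⇒inj₁∈ L I∈)

sets-map-inj₁ : ∀ {n} (L : List (Subset n)) → sets (map inj₁ L) ≡ L
sets-map-inj₁ []      = refl
sets-map-inj₁ (I ∷ L) = cong (I ∷_) (sets-map-inj₁ L)

inj₂∉map-inj₁ : ∀ {n} {i : Fin n} (L : List (Subset n)) → ¬ (inj₂ i ∈ map inj₁ L)
inj₂∉map-inj₁ L i∈ with ∈-map⁻ inj₁ i∈
... | _ , _ , ()

⊆-⋃ : ∀ {n} {I : Subset n} (F : List (Subset n)) → I ∈ F → I ⊆ ⋃ F
⊆-⋃ (J ∷ F) (here refl) = p⊆p∪q (⋃ F)
⊆-⋃ (J ∷ F) (there I∈)  = q⊆p∪q J (⋃ F) ∘ ⊆-⋃ F I∈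

disjoint⇒∉ : ∀ {n} {I J : Subset n} {x} → Disjoint I J → x ∈ₛ I → x ∈ₛ J → ⊥
disjoint⇒∉ I∩J≡∅ x∈I x∈J = I∩J≡∅ (_ , x∈p∩q⁺ (x∈I , x∈J))

disjoint-partner : ∀ {n} {I : Subset n} (F : List (Subset n)) → length F ≥ 2 →
  AllPairs Disjoint F → I ∈ F → ∃ λ J → J ∈ F × (∀ {x} → x ∈ₛ I → x ∈ₛ J → ⊥)
disjoint-partner (I ∷ J ∷ F) (s≤s (s≤s z≤n)) ((I#J ∷ _) ∷ _) (here refl) =
  J , there (here refl) , disjoint⇒∉ I#J
disjoint-partner (I ∷ []) (s≤s ()) _ _
disjoint-partner (J ∷ F) _ (J#F ∷ _) (there I∈F) =
  J , here refl , λ x∈I x∈J → disjoint⇒∉ (All.lookup J#F I∈F) x∈J x∈I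

module _ {n : ℕ} (𝓑 : BuildingSet n) where
  open BuildingSet 𝓑

  NonMaximal : Subset n → Set
  NonMaximal I = B I × ¬ Maximal 𝓑 I

  nested⇒extNested-inj₁ : ∀ L → IsNested 𝓑 L → IsExtNested 𝓑 (map inj₁ L)
  nested⇒extNested-inj₁ L (nonMax , nestedOrDisjoint , noUnion) rewrite sets-map-inj₁ L =
    All.map proj₁ nonMax , nestedOrDisjoint , noUnion ,
    λ i I i∈ _ → ⊥-elim (inj₂∉map-inj₁ L i∈)

  extNested-inj₁⇒nested : ∀ L → All NonMaximal L → IsExtNested 𝓑 (map inj₁ L) → IsNested 𝓑 L
  extNested-inj₁⇒nested L nonMax E with sets (map inj₁ L) | sets-map-inj₁ L | E
  ... | _ | refl | (_ , nestedOrDisjoint , noUnion , _) = nonMax , nestedOrDisjoint , noUnion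

  ⋃∉B-of-maximal-member : ∀ F → All B F → length F ≥ 2 → AllPairs Disjoint F →
    Any (Maximal 𝓑) F → ¬ B (⋃ F)
  ⋃∉B-of-maximal-member F B-F |F|≥2 disjoint maxF B-⋃F with find maxF
  ... | I , I∈F , (_ , I-maximal) with disjoint-partner F |F|≥2 disjoint I∈F
  ... | J , J∈F , I#J with nonempty J (All.lookup B-F J∈F)
  ... | x , x∈J = I#J x∈I x∈J
    where
      x∈I : x ∈ₛ I
      x∈I = subst (x ∈ₛ_) (I-maximal (⋃ F) B-⋃F (⊆-⋃ F I∈F)) (⊆-⋃ F J∈F x∈J)

  flag⇒extFlag : IsFlag (IsNested 𝓑) → IsFlag (IsExtNested 𝓑)
  flag⇒extFlag flag L edge = B-sets , nestedOrDisjoint , noDisjointUnion , xᵢ∉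
    where
      setEdge : ∀ {I J} → I ∈ sets L → J ∈ sets L → IsExtNested 𝓑 (inj₁ I ∷ inj₁ J ∷ [])
      setEdge I∈ J∈ = edge _ _ (∈-sets⇒inj₁∈ L I∈) (∈-sets⇒inj₁∈ L J∈)

      B-sets : All B (sets L)
      B-sets = All.tabulate λ I∈ → All.head (proj₁ (setEdge I∈ I∈))

      nestedOrDisjoint : ∀ I J → I ∈ sets L → J ∈ sets L → NestedOrDisjoint I J
      nestedOrDisjoint I J I∈ J∈ = proj₁ (proj₂ (setEdge I∈ J∈)) I J (here refl) (there (here refl))

      xᵢ∉ : ∀ i I → inj₂ i ∈ L → inj₁ I ∈ L → i ∉ I
      xᵢ∉ i I i∈ I∈ = proj₂ (proj₂ (proj₂ (edge _ _ i∈ I∈))) i I (here refl) (there (here refl))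

      noDisjointUnion : NoDisjointUnionIn 𝓑 (sets L)
      noDisjointUnion F |F|≥2 F⊆ disjoint B-⋃F = ¬¬-excluded-middle λ
        { (yes maxF) → ⋃∉B-of-maximal-member F (All.map (All.lookup B-sets) F⊆) |F|≥2 disjoint maxF B-⋃F
        ; (no ¬maxF) → proj₂ (proj₂ (flag F (cliqueEdge (¬Any⇒All¬ F ¬maxF))))
                         F |F|≥2 (All.tabulate id) disjoint B-⋃F }
        where
          cliqueEdge : All (¬_ ∘ Maximal 𝓑) F → ∀ u v → u ∈ F → v ∈ F → IsNested 𝓑 (u ∷ v ∷ [])
          cliqueEdge ¬maxF u v u∈ v∈ = extNested-inj₁⇒nested (u ∷ v ∷ [])
            (nonMaximal u∈ ∷ nonMaximal v∈ ∷ []) (setEdge (All.lookup F⊆ u∈) (All.lookup F⊆ v∈))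
            where
              nonMaximal : ∀ {I} → I ∈ F → NonMaximal I
              nonMaximal I∈ = All.lookup B-sets (All.lookup F⊆ I∈) , All.lookup ¬maxF I∈

  extFlag⇒flag : IsFlag (IsExtNested 𝓑) → IsFlag (IsNested 𝓑)
  extFlag⇒flag extFlag L edge =
    extNested-inj₁⇒nested L (All.tabulate λ I∈ → All.head (proj₁ (edge _ _ I∈ I∈)))
      (extFlag (map inj₁ L) extEdge)
    where
      extEdge : ∀ u v → u ∈ map inj₁ L → v ∈ map inj₁ L → IsExtNested 𝓑 (u ∷ v ∷ [])
      extEdge u v u∈ v∈ with ∈-map⁻ inj₁ u∈ | ∈-map⁻ inj₁ v∈
      ... | I , I∈ , refl | J , J∈ , refl = nested⇒extNested-inj₁ (I ∷ J ∷ []) (edge I J I∈ J∈)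

proposition2p21 : ∀ (n : ℕ) (𝓑 : BuildingSet n) →
    IsFlag (IsNested 𝓑) ⇔ IsFlag (IsExtNested 𝓑)
proposition2p21 n 𝓑 = mk⇔ (flag⇒extFlag 𝓑) (extFlag⇒flag 𝓑)
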